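{- For every integer $\ell\ge 3$, the theta graph $\theta_{1,2,\ell}$ is an $i$-graph.
   Context: For a graph $G$, an $i$-set is an independent dominating set of minimum cardinality. The $i$-graph $\mathcal{I}(G)$ has the $i$-sets as vertices, with $X\sim Y$ iff $Y=(X\setminus\{u\})\cup\{v\}$ for some $u\in X$, $v\notin X$ with $uv\in E(G)$; $H$ is an $i$-graph if $H\cong\mathcal{I}(G)$ for some $G$. $\theta_{j,k,\ell}$ denotes two vertices joined by three internally vertex-disjoint paths of lengths $j,k,\ell$. -}

module Defs where

open import Data.Nat using (ℕ; zero; suc; _≤_; _<_; s≤s; z≤n; pred; _<?_)
open import Data.Fin using (Fin; fromℕ<)
open import Data.Fin.Subset using (Subset; _∈_; _∉_; ∣_∣; _∪_; _-_; ⁅_⁆)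
open import Data.Product using (Σ; ∃; _×_; _,_)
open import Data.Sum using (_⊎_)
open import Data.Empty using (⊥)
open import Relation.Nullary using (¬_; yes; no)
open import Relation.Binary.PropositionalEquality using (_≡_)
open import Function.Bundles using (_⇔_)

record SimpleGraph (n : ℕ) : Set₁ where
  field
    Adj    : Fin n → Fin n → Set
    sym    : ∀ {x y} → Adj x y → Adj y x
    irrefl : ∀ {x} → ¬ Adj x x
open SimpleGraph public

module _ {n : ℕ} (G : SimpleGraph n) where

  Independent : Subset n → Set
  Independent S = ∀ x y → x ∈ S → y ∈ S → ¬ Adj G x y

  Dominating : Subset n → Set
  Dominating S = ∀ v → v ∈ S ⊎ (∃ λ u → u ∈ S × Adj G u v)

  IndepDominating : Subset n → Set
  IndepDominating S = Independent S × Dominating S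

  IsISet : Subset n → Set
  IsISet S = IndepDominating S × (∀ T → IndepDominating T → ∣ S ∣ ≤ ∣ T ∣)

  ISetAdj : Subset n → Subset n → Set
  ISetAdj X Y = ∃ λ u → ∃ λ v →
    u ∈ X × v ∉ X × Adj G u v × Y ≡ ((X - u) ∪ ⁅ v ⁆)

-- Theta graphs θ_{j,k,ℓ}: two ends joined by three internally disjoint
-- paths of lengths len 0 = j, len 1 = k, len 2 = ℓ.

lens : ℕ → ℕ → ℕ → Fin 3 → ℕ
lens j k l Fin.zero = j
lens j k l (Fin.suc Fin.zero) = k
lens j k l (Fin.suc (Fin.suc Fin.zero)) = l

-- vertices: the two ends, and the internal vertices of path p
-- (a path of length m has m - 1 internal vertices)
data ThetaV (j k l : ℕ) : Set where
  endA endB : ThetaV j k l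
  inner : (p : Fin 3) → Fin (pred (lens j k l p)) → ThetaV j k l

private
  lemma : ∀ {i m} → suc i < m → i < pred m
  lemma {m = suc m} (s≤s q) = q

-- the i-th vertex (0 ≤ i ≤ len p) along path p from endA to endB
pathVertex : ∀ {j k l} (p : Fin 3) → ℕ → ThetaV j k l
pathVertex p zero = endA
pathVertex {j} {k} {l} p (suc i) with suc i <? lens j k l p
... | yes lt = inner p (fromℕ< (lemma lt))
... | no _   = endB

ThetaAdj : ∀ {j k l} → ThetaV j k l → ThetaV j k l → Set
ThetaAdj {j} {k} {l} x y = ∃ λ (p : Fin 3) → ∃ λ i → i < lens j k l p ×
  ((x ≡ pathVertex p i × y ≡ pathVertex p (suc i)) ⊎
   (y ≡ pathVertex p i × x ≡ pathVertex p (suc i)))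

record IsoToIGraph {V : Set} (HAdj : V → V → Set) {n : ℕ} (G : SimpleGraph n) : Set where
  field
    f        : V → Subset n
    f-iset   : ∀ x → IsISet G (f x)
    f-inj    : ∀ x y → f x ≡ f y → x ≡ y
    f-onto   : ∀ S → IsISet G S → ∃ λ x → f x ≡ S
    f-adj    : ∀ x y → HAdj x y ⇔ ISetAdj G (f x) (f y)

IsIGraph : {V : Set} → (V → V → Set) → Set₁
IsIGraph HAdj = ∃ λ n → Σ (SimpleGraph n) λ G → IsoToIGraph HAdj G

module Submission where

-- θ_{1,2,ℓ} is the line graph of the graph F formed by the cycle C_{ℓ+1} with a pendant edge at
-- one cycle vertex: the ℓ + 1 cycle edges are the vertices of the long path, closed into a cycle
-- by the edge endA endB, and the pendant edge X meets exactly the two cycle edges endA and endB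
-- at that vertex. For ℓ ≥ 3, F is triangle-free without isolated vertices, and for any such F an
-- independent set of the complement Fᶜ is a clique of F, hence an edge or a single vertex; a
-- single vertex does not dominate Fᶜ, while an edge ab does, since no vertex is F-adjacent to
-- both a and b. So the i-sets of Fᶜ are exactly the edges of F, and swapping one vertex of an
-- i-set for another moves to an edge sharing the remaining endpoint: I(Fᶜ) is the line graph of F.

open import Defs hiding (sym)
open import Data.Nat using (ℕ; zero; suc; _+_; _≤_; _<_; s≤s; z≤n; _<?_)
import Data.Nat.Properties as ℕ
open import Data.Fin using (Fin; zero; suc; toℕ; inject₁; fromℕ<)
open import Data.Fin.Properties using (_≟_; toℕ<n; toℕ-inject₁; toℕ-fromℕ<; toℕ-injective)
open import Data.Fin.Subset using (Subset; _∈_; _∉_; ∣_∣; _∪_; _-_; _─_; ⁅_⁆; _⊆_; inside; outside)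
open import Data.Fin.Subset.Properties
  using (x∈⁅x⁆; x∈⁅y⁆⇒x≡y; ∣⁅x⁆∣≡1; x∈p∪q⁺; x∈p∪q⁻; x∈p∧x≢y⇒x∈p-y; x∈p⇒∣p-x∣<∣p∣;
         p─q⊆p; p⊆q⇒∣p∣≤∣q∣; ⊆-antisym; ∪-comm)
open import Data.Vec using ([]; _∷_; here; there)
open import Data.Product using (∃; ∃₂; _×_; _,_; proj₁)
open import Data.Sum using (_⊎_; inj₁; inj₂)
import Data.Sum as Sum
open import Data.Empty using (⊥; ⊥-elim)
open import Relation.Nullary using (¬_; yes; no; Dec)
open import Relation.Nullary.Decidable using (_⊎-dec_)
open import Relation.Binary.PropositionalEquality
  using (_≡_; _≢_; refl; sym; trans; subst; subst₂; cong; module ≡-Reasoning)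
open import Function.Bundles using (_⇔_; mk⇔; Equivalence)

private
  variable
    n : ℕ

pair : Fin n → Fin n → Subset n
pair a b = ⁅ a ⁆ ∪ ⁅ b ⁆

∈-pair⁻ : ∀ {a b w : Fin n} → w ∈ pair a b → w ≡ a ⊎ w ≡ b
∈-pair⁻ {a = a} {b} h with x∈p∪q⁻ ⁅ a ⁆ ⁅ b ⁆ h
... | inj₁ h = inj₁ (x∈⁅y⁆⇒x≡y a h)
... | inj₂ h = inj₂ (x∈⁅y⁆⇒x≡y b h)

∈-pair⁺ : ∀ {a b w : Fin n} → w ≡ a ⊎ w ≡ b → w ∈ pair a b
∈-pair⁺ {a = a} (inj₁ refl) = x∈p∪q⁺ (inj₁ (x∈⁅x⁆ a))
∈-pair⁺ {b = b} (inj₂ refl) = x∈p∪q⁺ (inj₂ (x∈⁅x⁆ b))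

x∈p─q⇒x∉q : ∀ {p q : Subset n} {x} → x ∈ p ─ q → x ∉ q
x∈p─q⇒x∉q {p = _ ∷ _} {inside ∷ _} () here
x∈p─q⇒x∉q {p = _ ∷ _} {_ ∷ _} (there h) (there h') = x∈p─q⇒x∉q h h'

pair-replace : ∀ {w a b : Fin n} → w ≢ a → (pair w a - a) ∪ ⁅ b ⁆ ≡ pair w b
pair-replace {w = w} {a} {b} w≢a = ⊆-antisym ⊆pair ⊇pair
  where
  ⊆pair : (pair w a - a) ∪ ⁅ b ⁆ ⊆ pair w b
  ⊆pair h with x∈p∪q⁻ (pair w a - a) ⁅ b ⁆ h
  ... | inj₂ h = ∈-pair⁺ (inj₂ (x∈⁅y⁆⇒x≡y b h))
  ... | inj₁ h with ∈-pair⁻ (p─q⊆p (pair w a) ⁅ a ⁆ h)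
  ...   | inj₁ z≡w = ∈-pair⁺ (inj₁ z≡w)
  ...   | inj₂ refl = ⊥-elim (x∈p─q⇒x∉q h (x∈⁅x⁆ a))
  ⊇pair : pair w b ⊆ (pair w a - a) ∪ ⁅ b ⁆
  ⊇pair h with ∈-pair⁻ h
  ... | inj₁ refl = x∈p∪q⁺ (inj₁ (x∈p∧x≢y⇒x∈p-y (∈-pair⁺ (inj₁ refl)) w≢a))
  ... | inj₂ refl = x∈p∪q⁺ (inj₂ (x∈⁅x⁆ b))

∣p∪q∣≤∣p∣+∣q∣ : ∀ (p q : Subset n) → ∣ p ∪ q ∣ ≤ ∣ p ∣ + ∣ q ∣
∣p∪q∣≤∣p∣+∣q∣ [] [] = z≤n
∣p∪q∣≤∣p∣+∣q∣ (inside ∷ p) (inside ∷ q) =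
  s≤s (subst (∣ p ∪ q ∣ ≤_) (sym (ℕ.+-suc ∣ p ∣ ∣ q ∣)) (ℕ.m≤n⇒m≤1+n (∣p∪q∣≤∣p∣+∣q∣ p q)))
∣p∪q∣≤∣p∣+∣q∣ (inside ∷ p) (outside ∷ q) = s≤s (∣p∪q∣≤∣p∣+∣q∣ p q)
∣p∪q∣≤∣p∣+∣q∣ (outside ∷ p) (inside ∷ q) =
  subst (suc ∣ p ∪ q ∣ ≤_) (sym (ℕ.+-suc ∣ p ∣ ∣ q ∣)) (s≤s (∣p∪q∣≤∣p∣+∣q∣ p q))
∣p∪q∣≤∣p∣+∣q∣ (outside ∷ p) (outside ∷ q) = ∣p∪q∣≤∣p∣+∣q∣ p q

∣pair∣≤2 : ∀ (a b : Fin n) → ∣ pair a b ∣ ≤ 2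
∣pair∣≤2 a b = subst₂ (λ i j → ∣ pair a b ∣ ≤ i + j) (∣⁅x⁆∣≡1 a) (∣⁅x⁆∣≡1 b) (∣p∪q∣≤∣p∣+∣q∣ ⁅ a ⁆ ⁅ b ⁆)

2≤∣p∣ : ∀ {p : Subset n} {a b} → a ∈ p → b ∈ p → a ≢ b → 2 ≤ ∣ p ∣
2≤∣p∣ {p = p} {a} {b} a∈p b∈p a≢b = ℕ.≤-<-trans 1≤∣p-a∣ (x∈p⇒∣p-x∣<∣p∣ a∈p)
  where
  1≤∣p-a∣ : 1 ≤ ∣ p - a ∣
  1≤∣p-a∣ = subst (_≤ ∣ p - a ∣) (∣⁅x⁆∣≡1 b)
    (p⊆q⇒∣p∣≤∣q∣ λ h → subst (_∈ p - a) (sym (x∈⁅y⁆⇒x≡y b h))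
                          (x∈p∧x≢y⇒x∈p-y b∈p λ b≡a → a≢b (sym b≡a)))

complement : SimpleGraph n → SimpleGraph n
complement F = record
  { Adj    = λ a b → a ≢ b × ¬ Adj F a b
  ; sym    = λ (a≢b , ¬ab) → (λ b≡a → a≢b (sym b≡a)) , (λ ba → ¬ab (SimpleGraph.sym F ba))
  ; irrefl = λ (a≢a , _) → a≢a refl
  }

record EdgeLabelling (F : SimpleGraph n) (E : Set) : Set where
  field
    src tgt  : E → Fin n
    adjacent : ∀ x → Adj F (src x) (tgt x)

  Incident : E → Fin n → Set
  Incident x w = w ≡ src x ⊎ w ≡ tgt x

  field
    endpoints-determine : ∀ {x y} → Incident y (src x) → Incident y (tgt x) → x ≡ y
    covers              : ∀ {a b} → Adj F a b → ∃ λ x → Incident x a × Incident x b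

  LineAdj : E → E → Set
  LineAdj x y = x ≢ y × ∃ λ w → Incident x w × Incident y w

module ComplementOfTriangleFree {n : ℕ} (F : SimpleGraph n)
  (adj? : ∀ a b → Dec (Adj F a b))
  (triangle-free : ∀ {a b c} → Adj F a b → Adj F b c → Adj F a c → ⊥)
  (no-isolated : ∀ a → ∃ λ b → Adj F a b)
  (v₀ : Fin n)
  where

  Fᶜ : SimpleGraph n
  Fᶜ = complement F

  adj⇒≢ : ∀ {a b} → Adj F a b → a ≢ b
  adj⇒≢ ab refl = irrefl F ab

  independent⇒adj : ∀ {S a b} → Independent Fᶜ S → a ∈ S → b ∈ S → a ≢ b → Adj F a b
  independent⇒adj {a = a} {b} ind a∈S b∈S a≢b with adj? a b
  ... | yes ab = ab
  ... | no ¬ab = ⊥-elim (ind a b a∈S b∈S (a≢b , ¬ab))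

  -- An independent set of Fᶜ is a clique of F, so by triangle-freeness it has at most two vertices.
  independent≡pair : ∀ {S a b} → Independent Fᶜ S → Adj F a b → a ∈ S → b ∈ S → S ≡ pair a b
  independent≡pair {S} {a} {b} ind ab a∈S b∈S = ⊆-antisym S⊆pair pair⊆S
    where
    S⊆pair : S ⊆ pair a b
    S⊆pair {c} c∈S with c ≟ a | c ≟ b
    ... | yes c≡a | _       = ∈-pair⁺ (inj₁ c≡a)
    ... | no _    | yes c≡b = ∈-pair⁺ (inj₂ c≡b)
    ... | no c≢a  | no c≢b  = ⊥-elim (triangle-free ab
      (independent⇒adj ind b∈S c∈S λ b≡c → c≢b (sym b≡c))
      (independent⇒adj ind a∈S c∈S λ a≡c → c≢a (sym a≡c)))
    pair⊆S : pair a b ⊆ S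
    pair⊆S h with ∈-pair⁻ h
    ... | inj₁ refl = a∈S
    ... | inj₂ refl = b∈S

  pair-independent : ∀ {a b} → Adj F a b → Independent Fᶜ (pair a b)
  pair-independent ab x y x∈ y∈ (x≢y , ¬xy) with ∈-pair⁻ x∈ | ∈-pair⁻ y∈
  ... | inj₁ refl | inj₁ refl = x≢y refl
  ... | inj₁ refl | inj₂ refl = ¬xy ab
  ... | inj₂ refl | inj₁ refl = ¬xy (SimpleGraph.sym F ab)
  ... | inj₂ refl | inj₂ refl = x≢y refl

  pair-dominating : ∀ {a b} → Adj F a b → Dominating Fᶜ (pair a b)
  pair-dominating {a} {b} ab v with v ≟ a | v ≟ b
  ... | yes v≡a | _       = inj₁ (∈-pair⁺ (inj₁ v≡a))
  ... | no _    | yes v≡b = inj₁ (∈-pair⁺ (inj₂ v≡b))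
  ... | no v≢a  | no v≢b with adj? a v | adj? b v
  ...   | no ¬av | _      = inj₂ (a , ∈-pair⁺ (inj₁ refl) , (λ a≡v → v≢a (sym a≡v)) , ¬av)
  ...   | yes _  | no ¬bv = inj₂ (b , ∈-pair⁺ (inj₂ refl) , (λ b≡v → v≢b (sym b≡v)) , ¬bv)
  ...   | yes av | yes bv = ⊥-elim (triangle-free ab bv av)

  -- Any vertex a of T has an F-neighbour w; either w ∈ T, or the vertex of T dominating w in Fᶜ is,
  -- by independence, another F-neighbour of a.
  indepDominating⇒edge : ∀ {T} → IndepDominating Fᶜ T → ∃₂ λ a b → a ∈ T × b ∈ T × Adj F a b
  indepDominating⇒edge {T} (ind , dom) = edgeAt (memberOf (dom v₀))
    where
    memberOf : v₀ ∈ T ⊎ (∃ λ u → u ∈ T × Adj Fᶜ u v₀) → ∃ λ a → a ∈ T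
    memberOf (inj₁ v₀∈T)          = v₀ , v₀∈T
    memberOf (inj₂ (u , u∈T , _)) = u , u∈T
    edgeAt : (∃ λ a → a ∈ T) → ∃₂ λ a b → a ∈ T × b ∈ T × Adj F a b
    edgeAt (a , a∈T) with no-isolated a
    ... | w , aw with dom w
    ...   | inj₁ w∈T = a , w , a∈T , w∈T , aw
    ...   | inj₂ (u , u∈T , _ , ¬uw) with a ≟ u
    ...     | yes refl = ⊥-elim (¬uw aw)
    ...     | no a≢u   = a , u , a∈T , u∈T , independent⇒adj ind a∈T u∈T a≢u

  pair-isISet : ∀ {a b} → Adj F a b → IsISet Fᶜ (pair a b)
  pair-isISet {a} {b} ab = (pair-independent ab , pair-dominating ab) , minimal
    where
    minimal : ∀ T → IndepDominating Fᶜ T → ∣ pair a b ∣ ≤ ∣ T ∣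
    minimal T idT with indepDominating⇒edge idT
    ... | c , d , c∈T , d∈T , cd = ℕ.≤-trans (∣pair∣≤2 a b) (2≤∣p∣ c∈T d∈T (adj⇒≢ cd))

  pair-ISetAdj : ∀ {w a b} → Adj F w a → Adj F w b → a ≢ b → ISetAdj Fᶜ (pair w a) (pair w b)
  pair-ISetAdj {w} {a} {b} wa wb a≢b =
    a , b , ∈-pair⁺ (inj₂ refl) , b∉ , (a≢b , λ ab → triangle-free wa ab wb) , sym (pair-replace (adj⇒≢ wa))
    where
    b∉ : b ∉ pair w a
    b∉ h with ∈-pair⁻ h
    ... | inj₁ refl = irrefl F wb
    ... | inj₂ refl = a≢b refl

  module _ {E : Set} (ℰ : EdgeLabelling F E) where
    open EdgeLabelling ℰ

    edgeSet : E → Subset n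
    edgeSet x = pair (src x) (tgt x)

    edgeSet-injective : ∀ {x y} → edgeSet x ≡ edgeSet y → x ≡ y
    edgeSet-injective {x} eq = endpoints-determine
      (∈-pair⁻ (subst (src x ∈_) eq (∈-pair⁺ (inj₁ refl))))
      (∈-pair⁻ (subst (tgt x ∈_) eq (∈-pair⁺ (inj₂ refl))))

    edgeSet-surjective : ∀ S → IsISet Fᶜ S → ∃ λ x → edgeSet x ≡ S
    edgeSet-surjective S ((ind , dom) , _) with indepDominating⇒edge (ind , dom)
    ... | a , b , a∈S , b∈S , ab with covers ab
    ...   | x , a∈x , b∈x = x , trans
      (independent≡pair (pair-independent (adjacent x)) ab (∈-pair⁺ a∈x) (∈-pair⁺ b∈x))
      (sym (independent≡pair ind ab a∈S b∈S))

    edgeSet-through : ∀ {x w} → Incident x w → ∃ λ a → Adj F w a × edgeSet x ≡ pair w a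
    edgeSet-through {x} (inj₁ refl) = tgt x , adjacent x , refl
    edgeSet-through {x} (inj₂ refl) = src x , SimpleGraph.sym F (adjacent x) , ∪-comm ⁅ src x ⁆ ⁅ tgt x ⁆

    lineAdj⇒ISetAdj : ∀ {x y} → LineAdj x y → ISetAdj Fᶜ (edgeSet x) (edgeSet y)
    lineAdj⇒ISetAdj (x≢y , w , w∈x , w∈y) with edgeSet-through w∈x | edgeSet-through w∈y
    ... | a , wa , x≡wa | b , wb , y≡wb =
      subst₂ (ISetAdj Fᶜ) (sym x≡wa) (sym y≡wb) (pair-ISetAdj wa wb a≢b)
      where
      a≢b : a ≢ b
      a≢b refl = x≢y (edgeSet-injective (trans x≡wa (sym y≡wb)))

    -- The vertex of edgeSet x other than the removed one survives into edgeSet y.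
    ISetAdj⇒lineAdj : ∀ {x y} → ISetAdj Fᶜ (edgeSet x) (edgeSet y) → LineAdj x y
    ISetAdj⇒lineAdj {x} {y} (u , v , u∈x , v∉x , _ , y≡) with edgeSet-through (∈-pair⁻ u∈x)
    ... | w , uw , x≡uw = x≢y , w , ∈-pair⁻ w∈x , ∈-pair⁻ w∈y
      where
      x≢y : x ≢ y
      x≢y refl = v∉x (subst (v ∈_) (sym y≡) (x∈p∪q⁺ (inj₂ (x∈⁅x⁆ v))))
      w∈x : w ∈ edgeSet x
      w∈x = subst (w ∈_) (sym x≡uw) (∈-pair⁺ (inj₂ refl))
      w∈y : w ∈ edgeSet y
      w∈y = subst (w ∈_) (sym y≡) (x∈p∪q⁺ (inj₁ (x∈p∧x≢y⇒x∈p-y w∈x λ w≡u → adj⇒≢ uw (sym w≡u))))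

    lineGraph≅iGraph : {HAdj : E → E → Set} → (∀ x y → HAdj x y ⇔ LineAdj x y) → IsoToIGraph HAdj Fᶜ
    lineGraph≅iGraph HAdj⇔ = record
      { f      = edgeSet
      ; f-iset = λ x → pair-isISet (adjacent x)
      ; f-inj  = λ _ _ → edgeSet-injective
      ; f-onto = edgeSet-surjective
      ; f-adj  = λ x y → mk⇔ (λ h → lineAdj⇒ISetAdj (Equivalence.to (HAdj⇔ x y) h))
                             (λ h → Equivalence.from (HAdj⇔ x y) (ISetAdj⇒lineAdj h))
      }

module PendantCycle (m : ℕ) where

  L N : ℕ
  L = 3 + m
  N = 2 + L

  -- The edges of F, oriented upwards: the cycle 0 – 1 – ⋯ – L – 0 and the pendant edge 0 – (L + 1).
  data Arc : ℕ → ℕ → Set where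
    step    : ∀ {i} → i < L → Arc i (suc i)
    close   : Arc 0 L
    pendant : Arc 0 (suc L)

  arc? : ∀ i j → Dec (Arc i j)
  arc? zero j with j ℕ.≟ 1 | j ℕ.≟ L | j ℕ.≟ suc L
  ... | yes refl | _        | _        = yes (step (s≤s z≤n))
  ... | no _     | yes refl | _        = yes close
  ... | no _     | no _     | yes refl = yes pendant
  ... | no j≢1   | no j≢L   | no j≢1+L = no λ { (step _) → j≢1 refl ; close → j≢L refl ; pendant → j≢1+L refl }
  arc? (suc i) j with j ℕ.≟ suc (suc i) | suc i <? L
  ... | yes refl | yes i<L = yes (step i<L)
  ... | yes refl | no i≮L  = no λ { (step i<L) → i≮L i<L }
  ... | no j≢    | _       = no λ { (step _) → j≢ refl }

  arc⇒< : ∀ {i j} → Arc i j → i < j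
  arc⇒< (step _) = ℕ.n<1+n _
  arc⇒< close    = s≤s z≤n
  arc⇒< pendant  = s≤s z≤n

  arc-irrelevant : ∀ {i j} (p q : Arc i j) → p ≡ q
  arc-irrelevant (step p) (step q) = cong step (ℕ.<-irrelevant p q)
  arc-irrelevant close    close    = refl
  arc-irrelevant pendant  pendant  = refl

  -- Two consecutive arcs are steps i → i + 1 → i + 2, and as L ≥ 3 no arc jumps from i to i + 2.
  no-transitive-arc : ∀ {i j k} → Arc i j → Arc j k → Arc i k → ⊥
  no-transitive-arc (step _) (step _) ()
  no-transitive-arc close    (step L<L)   _ = ℕ.<-irrefl refl L<L
  no-transitive-arc pendant  (step 1+L<L) _ = ℕ.<-irrefl refl (ℕ.<-trans (ℕ.n<1+n L) 1+L<L)

  Link : ℕ → ℕ → Set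
  Link i j = Arc i j ⊎ Arc j i

  link-triangle-free : ∀ {i j k} → Link i j → Link j k → Link i k → ⊥
  link-triangle-free (inj₁ ij) (inj₁ jk) (inj₁ ik) = no-transitive-arc ij jk ik
  link-triangle-free (inj₁ ij) (inj₁ jk) (inj₂ ki) =
    ℕ.<-irrefl refl (ℕ.<-trans (arc⇒< ij) (ℕ.<-trans (arc⇒< jk) (arc⇒< ki)))
  link-triangle-free (inj₁ ij) (inj₂ kj) (inj₁ ik) = no-transitive-arc ik kj ij
  link-triangle-free (inj₁ ij) (inj₂ kj) (inj₂ ki) = no-transitive-arc ki ij kj
  link-triangle-free (inj₂ ji) (inj₁ jk) (inj₁ ik) = no-transitive-arc ji ik jk
  link-triangle-free (inj₂ ji) (inj₁ jk) (inj₂ ki) = no-transitive-arc jk ki ji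
  link-triangle-free (inj₂ ji) (inj₂ kj) (inj₁ ik) =
    ℕ.<-irrefl refl (ℕ.<-trans (arc⇒< ik) (ℕ.<-trans (arc⇒< kj) (arc⇒< ji)))
  link-triangle-free (inj₂ ji) (inj₂ kj) (inj₂ ki) = no-transitive-arc kj ji ki

  F : SimpleGraph N
  F = record
    { Adj    = λ a b → Link (toℕ a) (toℕ b)
    ; sym    = Sum.swap
    ; irrefl = Sum.[ arc-irrefl , arc-irrefl ]
    }
    where
    arc-irrefl : ∀ {i} → ¬ Arc i i
    arc-irrefl a = ℕ.<-irrefl refl (arc⇒< a)

  F-adj? : ∀ a b → Dec (Adj F a b)
  F-adj? a b = arc? (toℕ a) (toℕ b) ⊎-dec arc? (toℕ b) (toℕ a)

  F-no-isolated : ∀ a → ∃ λ b → Adj F a b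
  F-no-isolated zero = suc zero , inj₁ (step (s≤s z≤n))
  F-no-isolated (suc k) with toℕ k <? L
  ... | yes k<L = inject₁ k , inj₂ (subst (λ i → Arc i (suc (toℕ k))) (sym (toℕ-inject₁ k)) (step k<L))
  ... | no k≮L  = zero , inj₂ (subst (λ i → Arc 0 (suc i)) (sym k≡L) pendant)
    where
    k≡L : toℕ k ≡ L
    k≡L = ℕ.≤-antisym (ℕ.≤-pred (toℕ<n k)) (ℕ.≮⇒≥ k≮L)

  V : Set
  V = ThetaV 1 2 L

  pattern X = inner (suc zero) zero
  pattern I j = inner (suc (suc zero)) j

  vertexOn : Fin 3 → ℕ → V
  vertexOn = pathVertex {1} {2} {L}

  long : ℕ → V
  long = vertexOn (suc (suc zero))

  -- Each vertex of θ is an edge of F, recorded by its endpoints s x < t x: the long path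
  -- runs through the edges 01, 12, …, (L-1)L and ends at the edge 0L, and X is the pendant edge.
  s t : V → ℕ
  s endA            = 0
  s endB            = 0
  s (inner zero ())
  s X               = 0
  s (I j)           = suc (toℕ j)
  t endA            = 1
  t endB            = L
  t (inner zero ())
  t X               = suc L
  t (I j)           = suc (suc (toℕ j))

  arc-st : ∀ x → Arc (s x) (t x)
  arc-st endA            = step (s≤s z≤n)
  arc-st endB            = close
  arc-st (inner zero ())
  arc-st X               = pendant
  arc-st (I j)           = step (s≤s (toℕ<n j))

  t<N : ∀ x → t x < N
  t<N endA            = s≤s (s≤s z≤n)
  t<N endB            = ℕ.m≤n⇒m≤1+n (ℕ.n<1+n L)
  t<N (inner zero ())
  t<N X               = ℕ.n<1+n (suc L)
  t<N (I j)           = s≤s (s≤s (ℕ.m<n⇒m<1+n (toℕ<n j)))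

  s<N : ∀ x → s x < N
  s<N x = ℕ.<-trans (arc⇒< (arc-st x)) (t<N x)

  long-endpoints : ∀ i → i < L → s (long i) ≡ i × t (long i) ≡ suc i
  long-endpoints zero    _   = refl , refl
  long-endpoints (suc i) i<L with suc i <? L
  ... | yes 1+i<L = cong suc (toℕ-fromℕ< _) , cong (λ k → suc (suc k)) (toℕ-fromℕ< _)
  ... | no 1+i≮L  = ⊥-elim (1+i≮L i<L)

  long-L : long L ≡ endB
  long-L with L <? L
  ... | yes L<L = ⊥-elim (ℕ.<-irrefl refl L<L)
  ... | no _    = refl

  long-I : ∀ j → long (suc (toℕ j)) ≡ I j
  long-I j with suc (toℕ j) <? L
  ... | yes _    = cong I (toℕ-injective (toℕ-fromℕ< _))
  ... | no 1+j≮L = ⊥-elim (1+j≮L (s≤s (toℕ<n j)))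

  edgeAt : ∀ {i j} → Arc i j → V
  edgeAt (step {i} _) = long i
  edgeAt close        = endB
  edgeAt pendant      = X

  edgeAt-endpoints : ∀ {i j} (a : Arc i j) → s (edgeAt a) ≡ i × t (edgeAt a) ≡ j
  edgeAt-endpoints (step i<L) = long-endpoints _ i<L
  edgeAt-endpoints close      = refl , refl
  edgeAt-endpoints pendant    = refl , refl

  edgeAt-arc-st : ∀ x → edgeAt (arc-st x) ≡ x
  edgeAt-arc-st endA            = refl
  edgeAt-arc-st endB            = refl
  edgeAt-arc-st (inner zero ())
  edgeAt-arc-st X               = refl
  edgeAt-arc-st (I j)           = long-I j

  st-injective : ∀ {x y} → s x ≡ s y → t x ≡ t y → x ≡ y
  st-injective {x} {y} sx≡sy tx≡ty = begin
    x                   ≡⟨ edgeAt-arc-st x ⟨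
    edgeAt (arc-st x)   ≡⟨ edgeAt-cong (arc-st x) (arc-st y) sx≡sy tx≡ty ⟩
    edgeAt (arc-st y)   ≡⟨ edgeAt-arc-st y ⟩
    y                   ∎
    where
    open ≡-Reasoning
    edgeAt-cong : ∀ {i j i′ j′} (a : Arc i j) (b : Arc i′ j′) → i ≡ i′ → j ≡ j′ → edgeAt a ≡ edgeAt b
    edgeAt-cong a b refl refl = cong edgeAt (arc-irrelevant a b)

  Meets : V → ℕ → Set
  Meets x v = v ≡ s x ⊎ v ≡ t x

  edgeAt-meets : ∀ {i j} (a : Arc i j) → Meets (edgeAt a) i × Meets (edgeAt a) j
  edgeAt-meets a with edgeAt-endpoints a
  ... | s≡i , t≡j = inj₁ (sym s≡i) , inj₂ (sym t≡j)

  meets-determine : ∀ {x y} → Meets y (s x) → Meets y (t x) → x ≡ y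
  meets-determine {x} (inj₁ sx≡sy) (inj₁ tx≡sy) =
    ⊥-elim (ℕ.<-irrefl (trans sx≡sy (sym tx≡sy)) (arc⇒< (arc-st x)))
  meets-determine     (inj₁ sx≡sy) (inj₂ tx≡ty) = st-injective sx≡sy tx≡ty
  meets-determine {x} {y} (inj₂ sx≡ty) (inj₁ tx≡sy) =
    ⊥-elim (ℕ.<-asym (subst₂ _<_ sx≡ty tx≡sy (arc⇒< (arc-st x))) (arc⇒< (arc-st y)))
  meets-determine {x} (inj₂ sx≡ty) (inj₂ tx≡ty) =
    ⊥-elim (ℕ.<-irrefl (trans sx≡ty (sym tx≡ty)) (arc⇒< (arc-st x)))

  src tgt : V → Fin N
  src x = fromℕ< (s<N x)
  tgt x = fromℕ< (t<N x)

  Incident : V → Fin N → Set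
  Incident x w = w ≡ src x ⊎ w ≡ tgt x

  incident⇒meets : ∀ {x w} → Incident x w → Meets x (toℕ w)
  incident⇒meets (inj₁ refl) = inj₁ (toℕ-fromℕ< _)
  incident⇒meets (inj₂ refl) = inj₂ (toℕ-fromℕ< _)

  meets⇒incident : ∀ {x w v} → toℕ w ≡ v → Meets x v → Incident x w
  meets⇒incident w≡v (inj₁ v≡s) = inj₁ (toℕ-injective (trans (trans w≡v v≡s) (sym (toℕ-fromℕ< _))))
  meets⇒incident w≡v (inj₂ v≡t) = inj₂ (toℕ-injective (trans (trans w≡v v≡t) (sym (toℕ-fromℕ< _))))

  ℰ : EdgeLabelling F V
  ℰ = record
    { src                 = src
    ; tgt                 = tgt
    ; adjacent            = λ x → inj₁ (subst₂ Arc (sym (toℕ-fromℕ< _)) (sym (toℕ-fromℕ< _)) (arc-st x))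
    ; endpoints-determine = λ {x} s∈y t∈y → meets-determine
        (subst (Meets _) (toℕ-fromℕ< (s<N x)) (incident⇒meets s∈y))
        (subst (Meets _) (toℕ-fromℕ< (t<N x)) (incident⇒meets t∈y))
    ; covers              = covers
    }
    where
    covers : ∀ {a b} → Adj F a b → ∃ λ x → Incident x a × Incident x b
    covers (inj₁ ab) = let (i , j) = edgeAt-meets ab in edgeAt ab , meets⇒incident refl i , meets⇒incident refl j
    covers (inj₂ ba) = let (j , i) = edgeAt-meets ba in edgeAt ba , meets⇒incident refl i , meets⇒incident refl j

  ThetaAdjL : V → V → Set
  ThetaAdjL = ThetaAdj {1} {2} {L}

  Touch : V → V → Set
  Touch x y = ∃ λ v → Meets x v × Meets y v

  thetaAdj-sym : ∀ {x y} → ThetaAdjL x y → ThetaAdjL y x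
  thetaAdj-sym (p , i , i<ℓ , along) = p , i , i<ℓ , Sum.swap along

  long-consecutive : ∀ i → i < L → long i ≢ long (suc i) × Touch (long i) (long (suc i))
  long-consecutive i i<L with long-endpoints i i<L | suc i ℕ.≟ L
  ... | s≡i , t≡1+i | no 1+i≢L =
    (λ eq → ℕ.<-irrefl (trans (sym s≡i) (trans (cong s eq) s′≡1+i)) (ℕ.n<1+n i)) ,
    suc i , inj₂ (sym t≡1+i) , inj₁ (sym s′≡1+i)
    where
    s′≡1+i : s (long (suc i)) ≡ suc i
    s′≡1+i = proj₁ (long-endpoints (suc i) (ℕ.≤∧≢⇒< i<L 1+i≢L))
  ... | s≡i , t≡L | yes refl rewrite long-L =
    (λ eq → ℕ.0≢1+n (trans (sym (cong s eq)) s≡i)) , L , inj₂ (sym t≡L) , inj₂ refl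

  consecutive : ∀ p i → i < lens 1 2 L p →
                vertexOn p i ≢ vertexOn p (suc i) × Touch (vertexOn p i) (vertexOn p (suc i))
  consecutive zero             zero          _              = (λ ()) , 0 , inj₁ refl , inj₁ refl
  consecutive (suc zero)       zero          _              = (λ ()) , 0 , inj₁ refl , inj₁ refl
  consecutive (suc zero)       (suc zero)    _              = (λ ()) , 0 , inj₁ refl , inj₁ refl
  consecutive (suc (suc zero)) i             i<L            = long-consecutive i i<L
  consecutive zero             (suc _)       (s≤s ())
  consecutive (suc zero)       (suc (suc _)) (s≤s (s≤s ()))

  thetaAdj⇒touch : ∀ {x y} → ThetaAdjL x y → x ≢ y × Touch x y
  thetaAdj⇒touch (p , i , i<ℓ , inj₁ (refl , refl)) = consecutive p i i<ℓ
  thetaAdj⇒touch (p , i , i<ℓ , inj₂ (refl , refl)) with consecutive p i i<ℓ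
  ... | x≢y , v , mx , my = (λ eq → x≢y (sym eq)) , v , my , mx

  meets-zero : ∀ {x} → Meets x 0 → x ≡ endA ⊎ x ≡ endB ⊎ x ≡ X
  meets-zero {endA}            _ = inj₁ refl
  meets-zero {endB}            _ = inj₂ (inj₁ refl)
  meets-zero {inner zero ()}
  meets-zero {X}               _ = inj₂ (inj₂ refl)
  meets-zero {I _}             (inj₁ ())
  meets-zero {I _}             (inj₂ ())

  meets-long : ∀ {x k} → Meets x (suc k) → k < L → x ≡ long k ⊎ x ≡ long (suc k)
  meets-long {endA}            (inj₂ refl) _   = inj₁ refl
  meets-long {endB}            (inj₂ refl) _   = inj₂ (sym long-L)
  meets-long {inner zero ()}
  meets-long {X}               (inj₂ refl) L<L = ⊥-elim (ℕ.<-irrefl refl L<L)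
  meets-long {I j}             (inj₁ refl) _   = inj₂ (sym (long-I j))
  meets-long {I j}             (inj₂ refl) _   = inj₁ (sym (long-I j))

  meets-pendant : ∀ {x k} → Meets x (suc k) → ¬ k < L → x ≡ X
  meets-pendant {endA}            (inj₂ refl) k≮L = ⊥-elim (k≮L (s≤s z≤n))
  meets-pendant {endB}            (inj₂ refl) k≮L = ⊥-elim (k≮L ℕ.≤-refl)
  meets-pendant {inner zero ()}
  meets-pendant {X}               (inj₂ refl) _   = refl
  meets-pendant {I j}             (inj₁ refl) k≮L = ⊥-elim (k≮L (ℕ.m<n⇒m<1+n (toℕ<n j)))
  meets-pendant {I j}             (inj₂ refl) k≮L = ⊥-elim (k≮L (s≤s (toℕ<n j)))

  A~B : ThetaAdjL endA endB
  A~B = zero , 0 , s≤s z≤n , inj₁ (refl , refl)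

  A~X : ThetaAdjL endA X
  A~X = suc zero , 0 , s≤s z≤n , inj₁ (refl , refl)

  X~B : ThetaAdjL X endB
  X~B = suc zero , 1 , s≤s (s≤s z≤n) , inj₁ (refl , refl)

  -- Classify both vertices by the shared endpoint: 0 is shared by endA, endB, X; each
  -- 1 ≤ k + 1 ≤ L by two consecutive vertices of the long path; L + 1 by X alone.
  touch⇒thetaAdj : ∀ {x y} → x ≢ y → Touch x y → ThetaAdjL x y
  touch⇒thetaAdj x≢y (zero , mx , my) with meets-zero mx | meets-zero my
  ... | inj₁ refl        | inj₁ refl        = ⊥-elim (x≢y refl)
  ... | inj₁ refl        | inj₂ (inj₁ refl) = A~B
  ... | inj₁ refl        | inj₂ (inj₂ refl) = A~X
  ... | inj₂ (inj₁ refl) | inj₁ refl        = thetaAdj-sym A~B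
  ... | inj₂ (inj₁ refl) | inj₂ (inj₁ refl) = ⊥-elim (x≢y refl)
  ... | inj₂ (inj₁ refl) | inj₂ (inj₂ refl) = thetaAdj-sym X~B
  ... | inj₂ (inj₂ refl) | inj₁ refl        = thetaAdj-sym A~X
  ... | inj₂ (inj₂ refl) | inj₂ (inj₁ refl) = X~B
  ... | inj₂ (inj₂ refl) | inj₂ (inj₂ refl) = ⊥-elim (x≢y refl)
  touch⇒thetaAdj x≢y (suc k , mx , my) with k <? L
  ... | no k≮L = ⊥-elim (x≢y (trans (meets-pendant mx k≮L) (sym (meets-pendant my k≮L))))
  ... | yes k<L with meets-long mx k<L | meets-long my k<L
  ...   | inj₁ refl | inj₁ refl = ⊥-elim (x≢y refl)
  ...   | inj₁ refl | inj₂ refl = suc (suc zero) , k , k<L , inj₁ (refl , refl)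
  ...   | inj₂ refl | inj₁ refl = suc (suc zero) , k , k<L , inj₂ (refl , refl)
  ...   | inj₂ refl | inj₂ refl = ⊥-elim (x≢y refl)

  thetaAdj⇔lineAdj : ∀ x y → ThetaAdjL x y ⇔ EdgeLabelling.LineAdj ℰ x y
  thetaAdj⇔lineAdj x y = mk⇔
    (λ x~y → let (x≢y , _ , mx , my) = thetaAdj⇒touch x~y in x≢y , shared mx my)
    (λ (x≢y , w , w∈x , w∈y) → touch⇒thetaAdj x≢y (toℕ w , incident⇒meets w∈x , incident⇒meets w∈y))
    where
    shared : ∀ {v} → Meets x v → Meets y v → ∃ λ w → Incident x w × Incident y w
    shared (inj₁ v≡s) my = src x , inj₁ refl , meets⇒incident (trans (toℕ-fromℕ< _) (sym v≡s)) my
    shared (inj₂ v≡t) my = tgt x , inj₂ refl , meets⇒incident (trans (toℕ-fromℕ< _) (sym v≡t)) my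

  θ-isIGraph : IsIGraph ThetaAdjL
  θ-isIGraph = N , complement F , lineGraph≅iGraph ℰ thetaAdj⇔lineAdj
    where
    open ComplementOfTriangleFree F F-adj? link-triangle-free F-no-isolated zero

mainTheorem12 : (ℓ : ℕ) → 3 ≤ ℓ → IsIGraph (ThetaAdj {1} {2} {ℓ})
mainTheorem12 (suc (suc (suc m))) _ = PendantCycle.θ-isIGraph m
mainTheorem12 1 (s≤s ())
mainTheorem12 2 (s≤s (s≤s ()))
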